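{- $T(\mathbin{;},\subseteq,\nabla)$ is exactly the class of dual ordered semigroups with zero.
   Context: For a non-empty set $X$, a binary relation on $X$ is total if its domain and its range are both $X$; $\nabla=X\times X$ is the full relation. $s\mathbin{;}t=\{(x,y):\exists z((x,z)\in s\wedge(z,y)\in t)\}$. $T(\mathbin{;},\subseteq,\nabla)$ is the closure under isomorphism of the class of structures $(B,\mathbin{;},\subseteq,\nabla)$ where $B$ is a set of total relations on some non-empty set $X$, closed under $\mathbin{;}$ and containing $\nabla$. An ordered semigroup is $(S,\cdot,\leq)$ with $\cdot$ associative, $\leq$ a partial order and $\cdot$ monotone in each argument. A dual ordered semigroup with zero is $(S,\cdot,0,\leq)$ with $(S,\cdot,\leq)$ an ordered semigroup, $0$ a semigroup zero, and $x\leq 0$ for all $x$. -}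

module Defs where

open import Data.Product using (Σ; ∃; _×_; _,_)
open import Relation.Binary.PropositionalEquality using (_≡_)
open import Relation.Binary.Structures using (IsPartialOrder)
open import Function using (_⇔_)
open import Data.Unit using (⊤)

BinRel : Set → Set₁
BinRel X = X → X → Set

_⨾_ : {X : Set} → BinRel X → BinRel X → BinRel X
(s ⨾ t) x y = ∃ λ z → s x z × t z y

_⊆ᵣ_ : {X : Set} → BinRel X → BinRel X → Set
s ⊆ᵣ t = ∀ x y → s x y → t x y

_≐_ : {X : Set} → BinRel X → BinRel X → Set
s ≐ t = (s ⊆ᵣ t) × (t ⊆ᵣ s)

∇ : {X : Set} → BinRel X
∇ _ _ = ⊤

IsTotal : {X : Set} → BinRel X → Set
IsTotal {X} r = (∀ x → ∃ λ y → r x y) × (∀ y → ∃ λ x → r x y)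

record Structure : Set₁ where
  field
    S    : Set
    _·_  : S → S → S
    _≤_  : S → S → Set
    𝟘    : S

-- Membership of T(;,⊆,∇): isomorphic to (B, ;, ⊆, ∇) with B a set of total
-- relations on a non-empty X, closed under ; and containing ∇.
-- Equivalently: an injective map f : S → total relations on X (its image is B)
-- with f (a · b) = f a ; f b, f 𝟘 = ∇, and a ≤ b ⇔ f a ⊆ f b.
-- (Closure of the image under ; and ∇ ∈ image follow from these.)
record Representation (A : Structure) (X : Set) : Set₁ where
  open Structure A
  field
    point     : X
    f         : S → BinRel X
    total     : ∀ a → IsTotal (f a)
    injective : ∀ a b → f a ≐ f b → a ≡ b
    hom-·     : ∀ a b → f (a · b) ≐ (f a ⨾ f b)
    hom-𝟘     : f 𝟘 ≐ ∇
    order     : ∀ a b → (a ≤ b) ⇔ (f a ⊆ᵣ f b)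

InT : Structure → Set₁
InT A = Σ Set λ X → Representation A X

record IsDualOrderedSemigroupWithZero (A : Structure) : Set₁ where
  open Structure A
  field
    assoc        : ∀ x y z → (x · y) · z ≡ x · (y · z)
    isPartialOrder : IsPartialOrder _≡_ _≤_
    monoˡ        : ∀ {x y} z → x ≤ y → (x · z) ≤ (y · z)
    monoʳ        : ∀ {x y} z → x ≤ y → (z · x) ≤ (z · y)
    zeroˡ        : ∀ x → 𝟘 · x ≡ 𝟘
    zeroʳ        : ∀ x → x · 𝟘 ≡ 𝟘
    top          : ∀ x → x ≤ 𝟘

module Submission where

open import Defs
open import Data.Maybe using (Maybe; just; nothing; fromMaybe)
open import Data.Product using (_×_; _,_; proj₁; proj₂; ∃)
open import Data.Unit using (tt)
open import Function using (_⇔_; mk⇔; Equivalence)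
open import Level using (0ℓ) renaming (suc to lsuc)
open import Relation.Binary.Bundles using (Setoid)
open import Relation.Binary.Structures using (IsEquivalence; IsPartialOrder)
open import Relation.Binary.PropositionalEquality using (_≡_; refl; sym)
  renaming (isEquivalence to ≡-isEquivalence)
import Relation.Binary.Reasoning.Setoid as SetoidReasoning

-- Soundness holds because every law of dual ordered semigroups with zero is
-- true of relational composition and inclusion, with ∇ absorbing total
-- relations; the representation is faithful, so the laws transfer back.
-- Completeness: adjoin an identity 1 to S and let a act on S¹ by the
-- "residual" relation  x f(a) y  ⇔  y ≤ x·a.  Then f(a) relates 1 to a, so
-- f is injective and order-reflecting, and f(a·b) = f(a) ; f(b) follows from
-- monotonicity, with the intermediate point x·a.

module _ {X : Set} where

  ⊆ᵣ-refl : {r : BinRel X} → r ⊆ᵣ r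
  ⊆ᵣ-refl _ _ rxy = rxy

  ⊆ᵣ-trans : {r s t : BinRel X} → r ⊆ᵣ s → s ⊆ᵣ t → r ⊆ᵣ t
  ⊆ᵣ-trans r⊆s s⊆t x y rxy = s⊆t x y (r⊆s x y rxy)

  ≐-refl : {r : BinRel X} → r ≐ r
  ≐-refl = ⊆ᵣ-refl , ⊆ᵣ-refl

  ≐-isEquivalence : IsEquivalence (_≐_ {X})
  ≐-isEquivalence = record
    { refl  = ≐-refl
    ; sym   = λ (r⊆s , s⊆r) → s⊆r , r⊆s
    ; trans = λ (r⊆s , s⊆r) (s⊆t , t⊆s) → ⊆ᵣ-trans r⊆s s⊆t , ⊆ᵣ-trans t⊆s s⊆r
    }

  ≐-setoid : Setoid (lsuc 0ℓ) 0ℓ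
  ≐-setoid = record { isEquivalence = ≐-isEquivalence }

  ⨾-mono : {r r′ s s′ : BinRel X} → r ⊆ᵣ r′ → s ⊆ᵣ s′ → (r ⨾ s) ⊆ᵣ (r′ ⨾ s′)
  ⨾-mono r⊆r′ s⊆s′ x y (z , rxz , szy) = z , r⊆r′ x z rxz , s⊆s′ z y szy

  ⨾-cong : {r r′ s s′ : BinRel X} → r ≐ r′ → s ≐ s′ → (r ⨾ s) ≐ (r′ ⨾ s′)
  ⨾-cong (r⊆r′ , r′⊆r) (s⊆s′ , s′⊆s) = ⨾-mono r⊆r′ s⊆s′ , ⨾-mono r′⊆r s′⊆s

  ⨾-assoc : (r s t : BinRel X) → ((r ⨾ s) ⨾ t) ≐ (r ⨾ (s ⨾ t))
  ⨾-assoc r s t =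
      (λ { x y (w , (v , rxv , svw) , twy) → v , rxv , w , svw , twy })
    , (λ { x y (v , rxv , w , svw , twy) → w , (v , rxv , svw) , twy })

  ∇-⨾-surjective : {r : BinRel X} → (∀ y → ∃ λ x → r x y) → (∇ ⨾ r) ≐ ∇
  ∇-⨾-surjective surj = (λ _ _ _ → tt) , λ x y _ → let (z , rzy) = surj y in z , tt , rzy

  ⨾-∇-entire : {r : BinRel X} → (∀ x → ∃ λ y → r x y) → (r ⨾ ∇) ≐ ∇
  ⨾-∇-entire entire = (λ _ _ _ → tt) , λ x y _ → let (z , rxz) = entire x in z , rxz , tt

module Representable {A : Structure} {X : Set} (R : Representation A X) where
  open Structure A
  open Representation R
  open SetoidReasoning (≐-setoid {X})

  ≤⇒⊆ : ∀ {a b} → a ≤ b → f a ⊆ᵣ f b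
  ≤⇒⊆ {a} {b} = Equivalence.to (order a b)

  ⊆⇒≤ : ∀ {a b} → f a ⊆ᵣ f b → a ≤ b
  ⊆⇒≤ {a} {b} = Equivalence.from (order a b)

  ·-assoc : ∀ x y z → (x · y) · z ≡ x · (y · z)
  ·-assoc x y z = injective _ _ (begin
    f ((x · y) · z)    ≈⟨ hom-· (x · y) z ⟩
    f (x · y) ⨾ f z    ≈⟨ ⨾-cong (hom-· x y) ≐-refl ⟩
    (f x ⨾ f y) ⨾ f z  ≈⟨ ⨾-assoc (f x) (f y) (f z) ⟩
    f x ⨾ (f y ⨾ f z)  ≈⟨ ⨾-cong ≐-refl (hom-· y z) ⟨
    f x ⨾ f (y · z)    ≈⟨ hom-· x (y · z) ⟨
    f (x · (y · z))    ∎)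

  ≤-isPartialOrder : IsPartialOrder _≡_ _≤_
  ≤-isPartialOrder = record
    { isPreorder = record
      { isEquivalence = ≡-isEquivalence
      ; reflexive     = λ { refl → ⊆⇒≤ ⊆ᵣ-refl }
      ; trans         = λ a≤b b≤c → ⊆⇒≤ (⊆ᵣ-trans (≤⇒⊆ a≤b) (≤⇒⊆ b≤c))
      }
    ; antisym = λ a≤b b≤a → injective _ _ (≤⇒⊆ a≤b , ≤⇒⊆ b≤a)
    }

  ·-mono-⊆ : ∀ {a a′ b b′} → f a ⊆ᵣ f a′ → f b ⊆ᵣ f b′ → (a · b) ≤ (a′ · b′)
  ·-mono-⊆ {a} {a′} {b} {b′} a⊆a′ b⊆b′ =
    ⊆⇒≤ (⊆ᵣ-trans (proj₁ (hom-· a b)) (⊆ᵣ-trans (⨾-mono a⊆a′ b⊆b′) (proj₂ (hom-· a′ b′))))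

  ·-monoˡ-≤ : ∀ {x y} z → x ≤ y → (x · z) ≤ (y · z)
  ·-monoˡ-≤ z x≤y = ·-mono-⊆ (≤⇒⊆ x≤y) ⊆ᵣ-refl

  ·-monoʳ-≤ : ∀ {x y} z → x ≤ y → (z · x) ≤ (z · y)
  ·-monoʳ-≤ z x≤y = ·-mono-⊆ ⊆ᵣ-refl (≤⇒⊆ x≤y)

  ·-zeroˡ : ∀ x → 𝟘 · x ≡ 𝟘
  ·-zeroˡ x = injective _ _ (begin
    f (𝟘 · x)  ≈⟨ hom-· 𝟘 x ⟩
    f 𝟘 ⨾ f x  ≈⟨ ⨾-cong hom-𝟘 ≐-refl ⟩
    ∇ ⨾ f x    ≈⟨ ∇-⨾-surjective (proj₂ (total x)) ⟩
    ∇          ≈⟨ hom-𝟘 ⟨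
    f 𝟘        ∎)

  ·-zeroʳ : ∀ x → x · 𝟘 ≡ 𝟘
  ·-zeroʳ x = injective _ _ (begin
    f (x · 𝟘)  ≈⟨ hom-· x 𝟘 ⟩
    f x ⨾ f 𝟘  ≈⟨ ⨾-cong ≐-refl hom-𝟘 ⟩
    f x ⨾ ∇    ≈⟨ ⨾-∇-entire (proj₁ (total x)) ⟩
    ∇          ≈⟨ hom-𝟘 ⟨
    f 𝟘        ∎)

  ≤-𝟘 : ∀ x → x ≤ 𝟘
  ≤-𝟘 x = ⊆⇒≤ λ p q _ → proj₂ hom-𝟘 p q tt

  isDualOrderedSemigroupWithZero : IsDualOrderedSemigroupWithZero A
  isDualOrderedSemigroupWithZero = record
    { assoc          = ·-assoc
    ; isPartialOrder = ≤-isPartialOrder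
    ; monoˡ          = ·-monoˡ-≤
    ; monoʳ          = ·-monoʳ-≤
    ; zeroˡ          = ·-zeroˡ
    ; zeroʳ          = ·-zeroʳ
    ; top            = ≤-𝟘
    }

module ResidualRepresentation {A : Structure} (D : IsDualOrderedSemigroupWithZero A) where
  open Structure A
  open IsDualOrderedSemigroupWithZero D
  open IsPartialOrder isPartialOrder using (antisym)
    renaming (refl to ≤-refl; trans to ≤-trans; reflexive to ≤-reflexive)

  -- Maybe S is S¹: nothing is the adjoined identity as a source point, but
  -- is read as 𝟘 as a target point (otherwise nothing would not be in the
  -- range of f a).
  _⋆_ : Maybe S → S → S
  nothing ⋆ a = a
  just x  ⋆ a = x · a

  ⌊_⌋ : Maybe S → S
  ⌊_⌋ = fromMaybe 𝟘

  f : S → BinRel (Maybe S)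
  f a x y = ⌊ y ⌋ ≤ (x ⋆ a)

  ⋆-assoc : ∀ x a b → x ⋆ (a · b) ≡ (x ⋆ a) · b
  ⋆-assoc nothing  a b = refl
  ⋆-assoc (just x) a b = sym (assoc x a b)

  ⋆-zeroʳ : ∀ x → x ⋆ 𝟘 ≡ 𝟘
  ⋆-zeroʳ nothing  = refl
  ⋆-zeroʳ (just x) = zeroʳ x

  ⋆-monoʳ-≤ : ∀ x {a b} → a ≤ b → (x ⋆ a) ≤ (x ⋆ b)
  ⋆-monoʳ-≤ nothing  a≤b = a≤b
  ⋆-monoʳ-≤ (just x) a≤b = monoʳ x a≤b

  𝟘≤⇒≡𝟘 : ∀ {s} → 𝟘 ≤ s → s ≡ 𝟘
  𝟘≤⇒≡𝟘 𝟘≤s = antisym (top _) 𝟘≤s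

  ⋆-monoˡ-≤ : ∀ z {s} b → ⌊ z ⌋ ≤ s → (z ⋆ b) ≤ (s · b)
  ⋆-monoˡ-≤ (just z) b z≤s = monoˡ b z≤s
  ⋆-monoˡ-≤ nothing  b 𝟘≤s rewrite 𝟘≤⇒≡𝟘 𝟘≤s | zeroˡ b = top b

  ≤-𝟘⋆ : ∀ x y → ⌊ y ⌋ ≤ (x ⋆ 𝟘)
  ≤-𝟘⋆ x y = ≤-trans (top _) (≤-reflexive (sym (⋆-zeroʳ x)))

  f-total : ∀ a → IsTotal (f a)
  f-total a = (λ x → just (x ⋆ a) , ≤-refl)
            , (λ y → just 𝟘 , ≤-trans (top _) (≤-reflexive (sym (zeroˡ a))))

  f-hom-· : ∀ a b → f (a · b) ≐ (f a ⨾ f b)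
  f-hom-· a b =
      (λ x y y≤xab → just (x ⋆ a) , ≤-refl , ≤-trans y≤xab (≤-reflexive (⋆-assoc x a b)))
    , (λ { x y (z , z≤xa , y≤zb) →
           ≤-trans y≤zb (≤-trans (⋆-monoˡ-≤ z b z≤xa) (≤-reflexive (sym (⋆-assoc x a b)))) })

  -- f a relates the adjoined identity to exactly the elements below a.
  f-order : ∀ a b → (a ≤ b) ⇔ (f a ⊆ᵣ f b)
  f-order a b = mk⇔ (λ a≤b x y y≤xa → ≤-trans y≤xa (⋆-monoʳ-≤ x a≤b))
                    (λ fa⊆fb → fa⊆fb nothing (just a) ≤-refl)

  representation : Representation A (Maybe S)
  representation = record
    { point     = nothing
    ; f         = f
    ; total     = f-total
    ; injective = λ a b (fa⊆fb , fb⊆fa) →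
                    antisym (Equivalence.from (f-order a b) fa⊆fb) (Equivalence.from (f-order b a) fb⊆fa)
    ; hom-·     = f-hom-·
    ; hom-𝟘     = (λ _ _ _ → tt) , (λ x y _ → ≤-𝟘⋆ x y)
    ; order     = f-order
    }

mainTheorem8 : (A : Structure) →
    (InT A → IsDualOrderedSemigroupWithZero A) × (IsDualOrderedSemigroupWithZero A → InT A)
mainTheorem8 A =
    (λ (X , R) → Representable.isDualOrderedSemigroupWithZero R)
  , (λ D → _ , ResidualRepresentation.representation D)
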